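{- Let $k\ge 3$, let $\mathbf{n}=(n_1,\dots,n_k)\in\mathbb{Z}_{>0}^k$ and assume $n_1\ge n_2\ge\dots\ge n_k$. (a) If $n_2\le (k-2)n_k$, then $\mathbf{n}$ is a lonely runner instance. (b) If $n_3\le (k-2)n_k$ and $n_2\ge k n_3$, then $\mathbf{n}$ is a lonely runner instance.
   Context: A vector $\mathbf{n}\in\mathbb{Z}_{>0}^k$ is a lonely runner instance if there exists a real number $t$ such that for all $1\le j\le k$ the distance of $tn_j$ to the nearest integer is at least $\frac{1}{k+1}$. -}

module Defs where

open import Data.Nat using (ℕ; suc)
open import Data.Integer as ℤ using (ℤ; +_)
open import Data.Rational using (ℚ; _/_; _*_; _-_; ∣_∣; _≤_)
open import Data.Fin using (Fin)
open import Data.Product using (Σ)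

ℕ→ℚ : ℕ → ℚ
ℕ→ℚ n = (+ n) / 1

-- ‖x‖ ≥ c, where ‖x‖ is the distance from x to the nearest integer:
-- every integer m is at distance at least c from x.
DistToIntAtLeast : ℚ → ℚ → Set
DistToIntAtLeast x c = (m : ℤ) → c ≤ ∣ x - (m / 1) ∣

LonelyRunnerInstance : (k : ℕ) → (Fin k → ℕ) → Set
LonelyRunnerInstance k n =
  Σ ℚ (λ t → (j : Fin k) → DistToIntAtLeast (t * ℕ→ℚ (n j)) ((+ 1) / suc k))

-- Take t = y / ((k + 1) n₁), with n₁ the fastest speed.  Runner N is then at distance
-- at least 1/(k + 1) from the integers as soon as y N / n₁ lies in a window
-- [p (k + 1) + 1, p (k + 1) + k]; for the fastest runner this says that y is not a
-- multiple of k + 1, which one of any two consecutive integers achieves.  In (a) all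
-- other runners use the window p = 0: taking y just above n₁ / n_k gives y N ≥ n₁,
-- and n₂ ≤ (k − 2) n_k bounds y N by k n₁.  In (b) the second runner gets its own
-- window p, the least one whose left end reaches n₂ / n_k, and y is taken just above
-- (p (k + 1) + 1) n₁ / n₂; then k n₃ ≤ n₂ keeps the runners 3, …, k inside [n₁, k n₁].
module Submission where

open import Defs
open import Data.Nat
open import Data.Nat.Properties
open import Data.Integer as ℤ using (ℤ; +_; -[1+_])
import Data.Integer.Properties as ℤ
import Data.Rational as ℚ
open ℚ using (ℚ; toℚᵘ; 0ℚ)
import Data.Rational.Properties as ℚ
open import Data.Rational.Unnormalised as ℚᵘ using (mkℚᵘ; *≡*; *≤*)
import Data.Rational.Unnormalised.Properties as ℚᵘ
open import Data.Rational.Solver using (module +-*-Solver)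
open import Data.Sum using (_⊎_; inj₁; inj₂)
open import Data.Product using (_×_; _,_; ∃-syntax; proj₁; proj₂)
open import Data.Fin using (Fin; zero; suc; fromℕ; toℕ)
open import Data.Fin.Properties using (≤fromℕ)
open import Data.Nat.DivMod using (m≡m%n+[m/n]*n; m%n<n; m/n*n≤m)
open import Data.List using ([]; _∷_)
open import Data.Nat.Tactic.RingSolver using (solve)
open import Relation.Binary.PropositionalEquality

infix 4 _≐_/1+_

-- x = a / (1 + b); the denominator is offset by one as in mkℚᵘ.
_≐_/1+_ : ℚ → ℕ → ℕ → Set
x ≐ a /1+ b = toℚᵘ x ℚᵘ.≃ mkℚᵘ (+ a) b

≐-/ : ∀ a d .{{_ : NonZero d}} → (+ a) ℚ./ d ≐ a /1+ pred d
≐-/ a (suc d) = ℚ.toℚᵘ-fromℚᵘ (mkℚᵘ (+ a) d)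

module _ {x y : ℚ} {a b c d : ℕ} (x≐ : x ≐ a /1+ b) (y≐ : y ≐ c /1+ d) where

  ≐-* : x ℚ.* y ≐ a * c /1+ (d + b * suc d)
  ≐-* = ℚᵘ.≃-trans (ℚ.toℚᵘ-homo-* x y) (ℚᵘ.≃-trans (ℚᵘ.*-cong x≐ y≐)
    (*≡* (cong (ℤ._* + suc (d + b * suc d)) (sym (ℤ.pos-* a c)))))

  ≐-+ : x ℚ.+ y ≐ a * suc d + c * suc b /1+ (d + b * suc d)
  ≐-+ = ℚᵘ.≃-trans (ℚ.toℚᵘ-homo-+ x y) (ℚᵘ.≃-trans (ℚᵘ.+-cong x≐ y≐)
    (*≡* (cong (ℤ._* + suc (d + b * suc d)) numerator)))
    where
    numerator : + a ℤ.* + suc d ℤ.+ + c ℤ.* + suc b ≡ + (a * suc d + c * suc b)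
    numerator = trans (cong₂ ℤ._+_ (sym (ℤ.pos-* a (suc d))) (sym (ℤ.pos-* c (suc b))))
                      (sym (ℤ.pos-+ (a * suc d) (c * suc b)))

  ≐-≤ : a * suc d ≤ c * suc b → x ℚ.≤ y
  ≐-≤ ad≤cb = ℚ.toℚᵘ-cancel-≤ (ℚᵘ.≤-respˡ-≃ (ℚᵘ.≃-sym x≐) (ℚᵘ.≤-respʳ-≃ (ℚᵘ.≃-sym y≐)
    (*≤* (subst₂ ℤ._≤_ (ℤ.pos-* a (suc d)) (ℤ.pos-* c (suc b)) (ℤ.+≤+ ad≤cb)))))

/1-mono-≤ : ∀ {i j} → i ℤ.≤ j → i ℚ./ 1 ℚ.≤ j ℚ./ 1
/1-mono-≤ {i} {j} i≤j = ℚ.toℚᵘ-cancel-≤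
  (ℚᵘ.≤-respˡ-≃ (ℚᵘ.≃-sym (ℚ.toℚᵘ-fromℚᵘ (mkℚᵘ i 0)))
  (ℚᵘ.≤-respʳ-≃ (ℚᵘ.≃-sym (ℚ.toℚᵘ-fromℚᵘ (mkℚᵘ j 0)))
  (*≤* (subst₂ ℤ._≤_ (sym (ℤ.*-identityʳ i)) (sym (ℤ.*-identityʳ j)) i≤j))))

≤+⊎+suc≤ : ∀ (m : ℤ) p → m ℤ.≤ + p ⊎ + suc p ℤ.≤ m
≤+⊎+suc≤ -[1+ _ ] p = inj₁ ℤ.-≤+
≤+⊎+suc≤ (+ n) p with ≤-<-connex n p
... | inj₁ n≤p = inj₁ (ℤ.+≤+ n≤p)
... | inj₂ p<n = inj₂ (ℤ.+≤+ p<n)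

module _ where
  open +-*-Solver using (_:+_; _:-_; :-_; _:=_) renaming (solve to solveℚ)

  c≤∣x-a∣ : ∀ {a c x} → 0ℚ ℚ.≤ c → a ℚ.+ c ℚ.≤ x → c ℚ.≤ ℚ.∣ x ℚ.- a ∣
  c≤∣x-a∣ {a} {c} {x} 0≤c a+c≤x =
    subst (c ℚ.≤_) (sym (ℚ.0≤p⇒∣p∣≡p (ℚ.≤-trans 0≤c c≤x-a))) c≤x-a
    where
    c≤x-a : c ℚ.≤ x ℚ.- a
    c≤x-a = subst (ℚ._≤ x ℚ.- a) (solveℚ 2 (λ a c → (a :+ c) :- a := c) refl a c)
                  (ℚ.+-monoˡ-≤ (ℚ.- a) a+c≤x)

  ∣x-a∣≡∣a-x∣ : ∀ x a → ℚ.∣ x ℚ.- a ∣ ≡ ℚ.∣ a ℚ.- x ∣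
  ∣x-a∣≡∣a-x∣ x a = trans (cong ℚ.∣_∣ (solveℚ 2 (λ x a → x :- a := :- (a :- x)) refl x a))
                          (ℚ.∣-p∣≡∣p∣ (a ℚ.- x))

between⇒distToInt : ∀ {x c} p → 0ℚ ℚ.≤ c
  → ℕ→ℚ p ℚ.+ c ℚ.≤ x → x ℚ.+ c ℚ.≤ ℕ→ℚ (suc p) → DistToIntAtLeast x c
between⇒distToInt {x} {c} p 0≤c lower upper m with ≤+⊎+suc≤ m p
... | inj₁ m≤p = c≤∣x-a∣ 0≤c (ℚ.≤-trans (ℚ.+-monoˡ-≤ c (/1-mono-≤ m≤p)) lower)
... | inj₂ p<m = subst (c ℚ.≤_) (sym (∣x-a∣≡∣a-x∣ x (m ℚ./ 1)))
                   (c≤∣x-a∣ 0≤c (ℚ.≤-trans upper (/1-mono-≤ p<m)))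

time : (k n₁ y : ℕ) .{{_ : NonZero n₁}} → ℚ
time k n₁ y = ((+ y) ℚ./ (suc k * n₁)) {{m*n≢0 (suc k) n₁}}

-- For v = y N this says that time k n₁ y * N lies in [p + 1/(k + 1), p + 1 − 1/(k + 1)].
InWindow : (k n₁ p v : ℕ) → Set
InWindow k n₁ p v = (p * suc k + 1) * n₁ ≤ v × v + n₁ ≤ suc p * suc k * n₁

window⇒distToInt : ∀ k n₁ y N p .{{_ : NonZero n₁}} → InWindow k n₁ p (y * N)
  → DistToIntAtLeast (time k n₁ y ℚ.* ℕ→ℚ N) ((+ 1) ℚ./ suc k)
window⇒distToInt k (suc n) y N p (lo , hi) =
  between⇒distToInt p 0≤c (≐-≤ (≐-+ (≐-/ p 1) c≐) x≐ lower)
                           (≐-≤ (≐-+ x≐ c≐) (≐-/ (suc p) 1) upper)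
  where
  open ≤-Reasoning
  c≐ : (+ 1) ℚ./ suc k ≐ 1 /1+ k
  c≐ = ≐-/ 1 (suc k)
  x≐ : time k (suc n) y ℚ.* ℕ→ℚ N ≐ y * N /1+ (n + k * suc n) * 1
  x≐ = ≐-* (≐-/ y (suc k * suc n)) (≐-/ N 1)
  0≤c : 0ℚ ℚ.≤ (+ 1) ℚ./ suc k
  0≤c = ≐-≤ (≐-/ 0 1) c≐ z≤n
  lower : (p * suc k + 1) * suc ((n + k * suc n) * 1) ≤ y * N * suc (k + 0)
  lower = begin
    (p * suc k + 1) * suc ((n + k * suc n) * 1) ≡⟨ solve (p ∷ k ∷ n ∷ []) ⟩
    suc k * ((p * suc k + 1) * suc n)           ≤⟨ *-monoʳ-≤ (suc k) lo ⟩
    suc k * (y * N)                             ≡⟨ solve (k ∷ y ∷ N ∷ []) ⟩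
    y * N * suc (k + 0)                         ∎
  upper : (y * N * suc k + 1 * suc ((n + k * suc n) * 1)) * 1
          ≤ suc p * suc (k + (n + k * suc n) * 1 * suc k)
  upper = begin
    (y * N * suc k + 1 * suc ((n + k * suc n) * 1)) * 1 ≡⟨ solve (y ∷ N ∷ k ∷ n ∷ []) ⟩
    suc k * (y * N + suc n)                             ≤⟨ *-monoʳ-≤ (suc k) hi ⟩
    suc k * (suc p * suc k * suc n)                     ≡⟨ solve (p ∷ k ∷ n ∷ []) ⟩
    suc p * suc (k + (n + k * suc n) * 1 * suc k)       ∎

firstWindow : ∀ k {n₁ v} → n₁ ≤ v → v ≤ k * n₁ → InWindow k n₁ 0 v
firstWindow k {n₁} {v} n₁≤v v≤kn₁ =
  subst (_≤ v) (sym (*-identityˡ n₁)) n₁≤v ,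
  (begin
    v + n₁         ≤⟨ +-monoˡ-≤ n₁ v≤kn₁ ⟩
    k * n₁ + n₁    ≡⟨ solve (k ∷ n₁ ∷ []) ⟩
    1 * suc k * n₁ ∎)
  where open ≤-Reasoning

nonMultiple⇒window : ∀ {k n₁ p y} → p * suc k + 1 ≤ y → y + 1 ≤ suc p * suc k
  → InWindow k n₁ p (y * n₁)
nonMultiple⇒window {k} {n₁} {p} {y} lo hi =
  *-monoˡ-≤ n₁ lo ,
  (begin
    y * n₁ + n₁        ≡⟨ solve (y ∷ n₁ ∷ []) ⟩
    (y + 1) * n₁       ≤⟨ *-monoˡ-≤ n₁ hi ⟩
    suc p * suc k * n₁ ∎)
  where open ≤-Reasoning

nonMultiple-near : ∀ k .{{_ : NonZero k}} z → ∃[ y ] z ≤ y × y ≤ suc z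
  × ∃[ p ] p * suc k + 1 ≤ y × y + 1 ≤ suc p * suc k
nonMultiple-near k z with z % suc k | m≡m%n+[m/n]*n z (suc k) | m%n<n z (suc k)
... | zero  | z≡qK   | _ = suc z , n≤1+n z , ≤-refl , z / suc k , lo , hi
  where
  open ≤-Reasoning
  q : ℕ
  q = z / suc k
  lo : q * suc k + 1 ≤ suc z
  lo = ≤-reflexive (trans (+-comm (q * suc k) 1) (cong suc (sym z≡qK)))
  hi : suc z + 1 ≤ suc q * suc k
  hi = begin
    suc z + 1           ≡⟨ cong (λ w → suc w + 1) z≡qK ⟩
    suc (q * suc k) + 1 ≡⟨ +-comm (suc (q * suc k)) 1 ⟩
    2 + q * suc k       ≤⟨ +-monoˡ-≤ (q * suc k) (s≤s (>-nonZero⁻¹ k)) ⟩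
    suc k + q * suc k   ∎
... | suc r | z≡r+qK | r<K = z , ≤-refl , n≤1+n z , z / suc k , lo , hi
  where
  open ≤-Reasoning
  q : ℕ
  q = z / suc k
  lo : q * suc k + 1 ≤ z
  lo = begin
    q * suc k + 1     ≡⟨ +-comm (q * suc k) 1 ⟩
    1 + q * suc k     ≤⟨ +-monoˡ-≤ (q * suc k) (s≤s z≤n) ⟩
    suc r + q * suc k ≡⟨ sym z≡r+qK ⟩
    z                 ∎
  hi : z + 1 ≤ suc q * suc k
  hi = begin
    z + 1                   ≡⟨ cong (_+ 1) z≡r+qK ⟩
    suc r + q * suc k + 1   ≡⟨ +-comm (suc r + q * suc k) 1 ⟩
    suc (suc r) + q * suc k ≤⟨ +-monoˡ-≤ (q * suc k) r<K ⟩
    suc k + q * suc k       ∎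

m<[1+m/n]*n : ∀ m n .{{_ : NonZero n}} → m < suc (m / n) * n
m<[1+m/n]*n m n = begin-strict
  m                 ≡⟨ m≡m%n+[m/n]*n m n ⟩
  m % n + m / n * n <⟨ +-monoˡ-< (m / n * n) (m%n<n m n) ⟩
  n + m / n * n     ∎
  where open ≤-Reasoning

*-≤-rescale : ∀ x j {s n a} → x * s ≤ n → a ≤ j * s → x * a ≤ j * n
*-≤-rescale x j {s} {n} {a} xs≤n a≤js = begin
  x * a       ≤⟨ *-monoʳ-≤ x a≤js ⟩
  x * (j * s) ≡⟨ solve (x ∷ j ∷ s ∷ []) ⟩
  j * (x * s) ≤⟨ *-monoʳ-≤ j xs≤n ⟩
  j * n       ∎
  where open ≤-Reasoning

quotient-lower : ∀ X {s y N} .{{_ : NonZero s}} → suc (X / s) ≤ y → s ≤ N → X ≤ y * N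
quotient-lower X {s} {y} {N} y≥ s≤N = <⇒≤ (begin-strict
  X               <⟨ m<[1+m/n]*n X s ⟩
  suc (X / s) * s ≤⟨ *-mono-≤ y≥ s≤N ⟩
  y * N           ∎)
  where open ≤-Reasoning

quotient-upper : ∀ X {a y} .{{_ : NonZero a}} → y ≤ 2 + X / a → y * a ≤ a + (a + X)
quotient-upper X {a} {y} y≤ = begin
  y * a               ≤⟨ *-monoˡ-≤ a y≤ ⟩
  a + (a + X / a * a) ≤⟨ +-monoʳ-≤ a (+-monoʳ-≤ a (m/n*n≤m X a)) ⟩
  a + (a + X)         ∎
  where open ≤-Reasoning

slowWindow-a : ∀ j {n₁ s a N y} .{{_ : NonZero s}} → a ≤ n₁ → a ≤ j * s → s ≤ N → N ≤ a
  → suc (n₁ / s) ≤ y → y ≤ 2 + n₁ / s → InWindow (2 + j) n₁ 0 (y * N)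
slowWindow-a j {n₁} {s} {a} {N} {y} a≤n₁ a≤js s≤N N≤a y≥ y≤ =
  firstWindow (2 + j) (quotient-lower n₁ y≥ s≤N) (begin
    y * N                ≤⟨ *-mono-≤ y≤ N≤a ⟩
    a + (a + n₁ / s * a) ≤⟨ +-mono-≤ a≤n₁ (+-mono-≤ a≤n₁ n₁/s*a≤j*n₁) ⟩
    n₁ + (n₁ + j * n₁)   ∎)
  where
  open ≤-Reasoning
  n₁/s*a≤j*n₁ : n₁ / s * a ≤ j * n₁
  n₁/s*a≤j*n₁ = *-≤-rescale (n₁ / s) j (m/n*n≤m n₁ s) a≤js

slowWindow-b : ∀ k {n₁ a c s N y w} .{{_ : NonZero a}}
  → a ≤ (w + 1) * s → (w + k) * c ≤ k * a
  → (w + 1) * n₁ ≤ y * a → y * a ≤ (w + k) * n₁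
  → s ≤ N → N ≤ c → InWindow k n₁ 0 (y * N)
slowWindow-b k {n₁} {a} {c} {s} {N} {y} {w} a≤ wc≤ka lo hi s≤N N≤c =
  firstWindow k (≤-trans (*-cancelʳ-≤ n₁ (y * s) a n₁a≤ysa) (*-monoʳ-≤ y s≤N))
              (*-cancelʳ-≤ (y * N) (k * n₁) a yNa≤kn₁a)
  where
  open ≤-Reasoning
  n₁a≤ysa : n₁ * a ≤ y * s * a
  n₁a≤ysa = begin
    n₁ * a             ≤⟨ *-monoʳ-≤ n₁ a≤ ⟩
    n₁ * ((w + 1) * s) ≡⟨ solve (n₁ ∷ w ∷ s ∷ []) ⟩
    (w + 1) * n₁ * s   ≤⟨ *-monoˡ-≤ s lo ⟩
    y * a * s          ≡⟨ solve (y ∷ a ∷ s ∷ []) ⟩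
    y * s * a          ∎
  yNa≤kn₁a : y * N * a ≤ k * n₁ * a
  yNa≤kn₁a = begin
    y * N * a            ≤⟨ *-monoˡ-≤ a (*-monoʳ-≤ y N≤c) ⟩
    y * c * a            ≡⟨ solve (y ∷ c ∷ a ∷ []) ⟩
    y * a * c            ≤⟨ *-monoˡ-≤ c hi ⟩
    (w + k) * n₁ * c     ≡⟨ solve (w ∷ k ∷ n₁ ∷ c ∷ []) ⟩
    n₁ * ((w + k) * c)   ≤⟨ *-monoʳ-≤ n₁ wc≤ka ⟩
    n₁ * (k * a)         ≡⟨ solve (n₁ ∷ k ∷ a ∷ []) ⟩
    k * n₁ * a           ∎

-- p is the least index with a ≤ (p (k + 1) + 1) s, which is ⌊a / ((k + 1) s)⌋ or one more.
secondWindow : ∀ i {a c s} .{{_ : NonZero s}} → c ≤ suc i * s → (3 + i) * c ≤ a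
  → ∃[ p ] a ≤ (p * (4 + i) + 1) * s × (p * (4 + i) + (3 + i)) * c ≤ (3 + i) * a
secondWindow i {a} {c} {s} c≤is kc≤a =
  fromQuotient (a / Ks) (≤-trans (≤-reflexive (*-assoc (a / Ks) (4 + i) s)) (m/n*n≤m a Ks))
                        (m<[1+m/n]*n a Ks)
  where
  open ≤-Reasoning
  Ks : ℕ
  Ks = (4 + i) * s
  instance
    Ks≢0 : NonZero Ks
    Ks≢0 = m*n≢0 (4 + i) s
  fromQuotient : ∀ q → q * (4 + i) * s ≤ a → a < suc q * Ks
    → ∃[ p ] a ≤ (p * (4 + i) + 1) * s × (p * (4 + i) + (3 + i)) * c ≤ (3 + i) * a
  fromQuotient q qKs≤a a<[1+q]Ks with ≤-<-connex a ((q * (4 + i) + 1) * s)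
  ... | inj₁ a≤ = q , a≤ , (begin
    (q * (4 + i) + (3 + i)) * c   ≡⟨ *-distribʳ-+ c (q * (4 + i)) (3 + i) ⟩
    q * (4 + i) * c + (3 + i) * c
      ≤⟨ +-mono-≤ (*-≤-rescale (q * (4 + i)) (suc i) qKs≤a c≤is) kc≤a ⟩
    suc i * a + a                 ≤⟨ m≤n+m (suc i * a + a) a ⟩
    a + (suc i * a + a)           ≡⟨ solve (i ∷ a ∷ []) ⟩
    (3 + i) * a                   ∎)
  ... | inj₂ [qK+1]s<a = suc q , a≤ , (begin
    (suc q * (4 + i) + (3 + i)) * c   ≡⟨ solve (q ∷ i ∷ c ∷ []) ⟩
    (q * (4 + i) + 1) * c + ((3 + i) * c + (3 + i) * c)
      ≤⟨ +-mono-≤ (*-≤-rescale (q * (4 + i) + 1) (suc i) (<⇒≤ [qK+1]s<a) c≤is)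
                  (+-mono-≤ kc≤a kc≤a) ⟩
    suc i * a + (a + a)               ≡⟨ solve (i ∷ a ∷ []) ⟩
    (3 + i) * a                       ∎)
    where
    a≤ : a ≤ (suc q * (4 + i) + 1) * s
    a≤ = <⇒≤ (begin-strict
      a                         <⟨ a<[1+q]Ks ⟩
      suc q * ((4 + i) * s)     ≤⟨ m≤m+n (suc q * ((4 + i) * s)) s ⟩
      suc q * ((4 + i) * s) + s ≡⟨ solve (q ∷ i ∷ s ∷ []) ⟩
      (suc q * (4 + i) + 1) * s ∎)

secondAndSlowWindows : ∀ i {n₁ a c s y p} .{{_ : NonZero a}} → a ≤ n₁
  → a ≤ (p * (4 + i) + 1) * s → (p * (4 + i) + (3 + i)) * c ≤ (3 + i) * a
  → suc ((p * (4 + i) + 1) * n₁ / a) ≤ y → y ≤ 2 + (p * (4 + i) + 1) * n₁ / a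
  → InWindow (3 + i) n₁ p (y * a) × (∀ {N} → s ≤ N → N ≤ c → InWindow (3 + i) n₁ 0 (y * N))
secondAndSlowWindows i {n₁} {a} {c} {s} {y} {p} a≤n₁ a≤ wc≤ka y≥ y≤ =
  (quotient-lower X y≥ ≤-refl , second-upper) ,
  slowWindow-b (3 + i) {y = y} {w = p * (4 + i)} a≤ wc≤ka (quotient-lower X y≥ ≤-refl)
    (≤-trans ya≤ (*-monoˡ-≤ n₁ (+-monoʳ-≤ (p * (4 + i)) (m≤m+n 3 i))))
  where
  open ≤-Reasoning
  X : ℕ
  X = (p * (4 + i) + 1) * n₁
  ya≤ : y * a ≤ (p * (4 + i) + 3) * n₁
  ya≤ = begin
    y * a                              ≤⟨ quotient-upper X y≤ ⟩
    a + (a + X)                        ≤⟨ +-mono-≤ a≤n₁ (+-monoˡ-≤ X a≤n₁) ⟩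
    n₁ + (n₁ + (p * (4 + i) + 1) * n₁) ≡⟨ solve (p ∷ i ∷ n₁ ∷ []) ⟩
    (p * (4 + i) + 3) * n₁             ∎
  second-upper : y * a + n₁ ≤ suc p * (4 + i) * n₁
  second-upper = begin
    y * a + n₁                   ≤⟨ +-monoˡ-≤ n₁ ya≤ ⟩
    (p * (4 + i) + 3) * n₁ + n₁  ≡⟨ solve (p ∷ i ∷ n₁ ∷ []) ⟩
    (p * (4 + i) + 4) * n₁       ≤⟨ *-monoˡ-≤ n₁ (+-monoʳ-≤ (p * (4 + i)) (m≤m+n 4 i)) ⟩
    (p * (4 + i) + (4 + i)) * n₁ ≡⟨ solve (p ∷ i ∷ n₁ ∷ []) ⟩
    suc p * (4 + i) * n₁         ∎

lonelyRunner-a : ∀ j (n : Fin (2 + j) → ℕ) {s a}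
  .{{_ : NonZero s}} .{{_ : NonZero (n zero)}}
  → a ≤ n zero → a ≤ j * s → (∀ l → s ≤ n (suc l) × n (suc l) ≤ a)
  → LonelyRunnerInstance (2 + j) n
lonelyRunner-a j n {s} a≤n₁ a≤js slow with nonMultiple-near (2 + j) (suc (n zero / s))
... | y , y≥ , y≤ , p , lo , hi = time (2 + j) (n zero) y , λ where
  zero    → window⇒distToInt (2 + j) (n zero) y _ p
              (nonMultiple⇒window {k = 2 + j} {p = p} lo hi)
  (suc l) → window⇒distToInt (2 + j) (n zero) y _ 0
              (slowWindow-a j a≤n₁ a≤js (proj₁ (slow l)) (proj₂ (slow l)) y≥ y≤)

lonelyRunner-b : ∀ i (n : Fin (3 + i) → ℕ) {s c} .{{_ : NonZero s}}
  .{{_ : NonZero (n zero)}} .{{_ : NonZero (n (suc zero))}}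
  → n (suc zero) ≤ n zero → c ≤ suc i * s → (3 + i) * c ≤ n (suc zero)
  → (∀ l → s ≤ n (suc (suc l)) × n (suc (suc l)) ≤ c)
  → LonelyRunnerInstance (3 + i) n
lonelyRunner-b i n a≤n₁ c≤is kc≤a slow with secondWindow i c≤is kc≤a
... | p , a≤ , wc≤ka
  with nonMultiple-near (3 + i) (suc ((p * (4 + i) + 1) * n zero / n (suc zero)))
... | y , y≥ , y≤ , p₁ , lo , hi with secondAndSlowWindows i {p = p} a≤n₁ a≤ wc≤ka y≥ y≤
... | second , slowWindow = time (3 + i) (n zero) y , λ where
  zero          → window⇒distToInt (3 + i) (n zero) y _ p₁
                    (nonMultiple⇒window {k = 3 + i} {p = p₁} lo hi)
  (suc zero)    → window⇒distToInt (3 + i) (n zero) y _ p second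
  (suc (suc l)) → window⇒distToInt (3 + i) (n zero) y _ 0
                    (slowWindow (proj₁ (slow l)) (proj₂ (slow l)))

theorem7 : (m : ℕ) (n : Fin (suc (suc (suc m))) → ℕ)
    → ((j : Fin (suc (suc (suc m)))) → 0 < n j)
    → ((i j : Fin (suc (suc (suc m)))) → toℕ i ≤ toℕ j → n j ≤ n i)
    → (n (suc zero) ≤ suc m * n (fromℕ (suc (suc m)))
         → LonelyRunnerInstance (suc (suc (suc m))) n)
      × (n (suc (suc zero)) ≤ suc m * n (fromℕ (suc (suc m)))
         → suc (suc (suc m)) * n (suc (suc zero)) ≤ n (suc zero)
         → LonelyRunnerInstance (suc (suc (suc m))) n)
theorem7 m n pos mono =
  (λ n₂≤ → lonelyRunner-a (suc m) n (≤n₁ (suc zero)) n₂≤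
             (λ l → slowest≤ (suc l) , mono (suc zero) (suc l) (s≤s z≤n))) ,
  (λ n₃≤ kn₃≤n₂ → lonelyRunner-b m n (≤n₁ (suc zero)) n₃≤ kn₃≤n₂
             (λ l → slowest≤ (suc (suc l)) ,
                    mono (suc (suc zero)) (suc (suc l)) (s≤s (s≤s z≤n))))
  where
  instance
    speed≢0 : ∀ {j} → NonZero (n j)
    speed≢0 {j} = >-nonZero (pos j)
  slowest≤ : ∀ j → n (fromℕ (suc (suc m))) ≤ n j
  slowest≤ j = mono j (fromℕ (suc (suc m))) (≤fromℕ j)
  ≤n₁ : ∀ j → n j ≤ n zero
  ≤n₁ j = mono zero j z≤n
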